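{- Let $\Gamma$ be a strongly regular graph with parameters $(v,k,\lambda,\mu)$ with $\mu=0$, and let $d$ be an integer with $0\le d\le k$. Then for every $y$ with $\mathrm{Haem}_{\geq}(\Gamma,d)<y<v$ there is an integer $b_y$ such that $R_\Gamma(b_y,y,d)<0$.
   Context: A graph is strongly regular with parameters $(v,k,\lambda,\mu)$ if it has $v$ vertices, is $k$-regular, is neither complete nor edgeless, every two adjacent vertices have exactly $\lambda$ common neighbours, and every two distinct non-adjacent vertices have exactly $\mu$ common neighbours. Its restricted eigenvalues $\rho>\sigma$ are the two roots of $t^2-(\lambda-\mu)t-(k-\mu)=0$. Define $\mathrm{Haem}_{\geq}(\Gamma,d)=v\frac{d-\sigma}{k-\sigma}$. The regular adjacency polynomial is $R_\Gamma(x,y,d)=x(x+1)(v-y)-2xyk+(2x+\lambda-\mu+1)yd+y(y-1)\mu-yd^2$. -}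

module Defs where

open import Data.Nat as ℕ using (ℕ; zero; suc)
open import Data.Integer as ℤ using (ℤ; +_)
open import Data.Rational as ℚ using (ℚ; 0ℚ; _/_)
open import Data.Rational.Properties as ℚP using ()
open import Data.Bool using (Bool; true; false; if_then_else_; _∧_; not)
open import Data.Fin using (Fin; zero; suc)
open import Data.Product using (Σ; ∃; _×_; _,_)
open import Relation.Binary.PropositionalEquality using (_≡_; _≢_)
open import Relation.Nullary using (yes; no)

countF : ∀ {n} → (Fin n → Bool) → ℕ
countF {zero}  P = 0
countF {suc n} P = (if P zero then 1 else 0) ℕ.+ countF (λ i → P (suc i))

record Graph (v : ℕ) : Set where
  field
    adj     : Fin v → Fin v → Bool
    symm    : ∀ i j → adj i j ≡ adj j i
    irrefl  : ∀ i → adj i i ≡ false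

open Graph public

degree : ∀ {v} → Graph v → Fin v → ℕ
degree G i = countF (adj G i)

commonNbrs : ∀ {v} → Graph v → Fin v → Fin v → ℕ
commonNbrs G i j = countF (λ w → adj G i w ∧ adj G j w)

record IsSRG {v : ℕ} (G : Graph v) (k lam mu : ℕ) : Set where
  field
    regular      : ∀ i → degree G i ≡ k
    notComplete  : ∃ λ i → ∃ λ j → i ≢ j × adj G i j ≡ false
    notEdgeless  : ∃ λ i → ∃ λ j → adj G i j ≡ true
    adjCommon    : ∀ i j → adj G i j ≡ true → commonNbrs G i j ≡ lam
    nonadjCommon : ∀ i j → i ≢ j → adj G i j ≡ false → commonNbrs G i j ≡ mu

ℤtoℚ : ℤ → ℚ
ℤtoℚ n = n / 1

IsRestrictedRoot : (k lam mu : ℕ) → ℚ → Set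
IsRestrictedRoot k lam mu t =
  t ℚ.* t ℚ.- ℤtoℚ (+ lam ℤ.- + mu) ℚ.* t ℚ.- ℤtoℚ (+ k ℤ.- + mu) ≡ 0ℚ

RestrictedEigenvalues : (k lam mu : ℕ) → ℚ → ℚ → Set
RestrictedEigenvalues k lam mu ρ σ =
  IsRestrictedRoot k lam mu ρ × IsRestrictedRoot k lam mu σ × σ ℚ.< ρ

-- total division on ℚ (division by 0 returns 0; never used in that case below,
-- since k > σ for an SRG)
divℚ : ℚ → ℚ → ℚ
divℚ p q with q ℚP.≟ 0ℚ
... | yes _ = 0ℚ
... | no q≢0 = ℚ._÷_ p q {{ℚ.≢-nonZero q≢0}}

Haem≥ : (v k : ℕ) (σ : ℚ) (d : ℤ) → ℚ
Haem≥ v k σ d = divℚ (ℤtoℚ (+ v) ℚ.* (ℤtoℚ d ℚ.- σ)) (ℤtoℚ (+ k) ℚ.- σ)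

R : (v k lam mu : ℕ) → ℤ → ℤ → ℤ → ℤ
R v k lam mu x y d =
  x ℤ.* (x ℤ.+ + 1) ℤ.* (+ v ℤ.- y)
  ℤ.- + 2 ℤ.* x ℤ.* y ℤ.* + k
  ℤ.+ (+ 2 ℤ.* x ℤ.+ + lam ℤ.- + mu ℤ.+ + 1) ℤ.* y ℤ.* d
  ℤ.+ y ℤ.* (y ℤ.- + 1) ℤ.* + mu
  ℤ.- y ℤ.* d ℤ.* d

-- In any strongly regular graph λ < k (for an edge ij, j is a neighbour of i but not a
-- common neighbour of i and j), so t² − (λ − μ)t − (k − μ) equals 1 + λ − k ≤ 0 at
-- t = −1, whence σ ≤ −1.  The Haemers hypothesis says v(d − σ) < y(k − σ); adding
-- (v − y)(−1 − σ) ≥ 0 gives v(d + 1) < y(k + 1), so y > 0.  For μ = 0 the witness is then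
-- explicit: R(d, y, d) = −d (y(k + 1) − v(d + 1) + y(k − λ − 1)) < 0 when d > 0, and
-- R(1, y, 0) = −2 (y(k + 1) − v) < 0.
{-# OPTIONS --safe #-}
module Submission where

open import Defs
open import Data.Bool using (Bool; true; false; if_then_else_; _∧_)
open import Data.Bool.Properties using (∧-zeroʳ)
open import Data.Fin using (Fin; zero; suc)
open import Data.Integer as ℤ using (ℤ; +_; +[1+_]; +≤+)
open import Data.Rational as ℚ using (ℚ)
import Data.Integer.Properties as ℤP
open import Data.Integer.Tactic.RingSolver using (solve-∀)
open import Data.Nat as ℕ using (ℕ; zero; suc; z≤n; s≤s)
import Data.Nat.Properties as ℕP
import Data.Nat.Coprimality as Coprime
open import Data.Product using (∃; _,_)
import Data.Rational.Properties as ℚP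
open import Function using (id)
open import Relation.Binary.PropositionalEquality
open import Relation.Nullary using (yes; no; contradiction)

if-mono-≤ : ∀ {a b m n} → (a ≡ true → b ≡ true) → m ℕ.≤ n →
            (if a then 1 else 0) ℕ.+ m ℕ.≤ (if b then 1 else 0) ℕ.+ n
if-mono-≤ {true}  {true}  _   = s≤s
if-mono-≤ {true}  {false} a⇒b = contradiction (a⇒b refl) λ ()
if-mono-≤ {false} {true}  _   = ℕP.m≤n⇒m≤1+n
if-mono-≤ {false} {false} _   = id

if-mono-< : ∀ {a b m n} → (a ≡ true → b ≡ true) → m ℕ.< n →
            (if a then 1 else 0) ℕ.+ m ℕ.< (if b then 1 else 0) ℕ.+ n
if-mono-< {a} {b} {m} {n} a⇒b m<n =
  subst (ℕ._≤ (if b then 1 else 0) ℕ.+ n) (ℕP.+-suc (if a then 1 else 0) m) (if-mono-≤ a⇒b m<n)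

countF-mono : ∀ {n} {P Q : Fin n → Bool} →
              (∀ i → P i ≡ true → Q i ≡ true) → countF P ℕ.≤ countF Q
countF-mono {zero}  _   = z≤n
countF-mono {suc n} P⊆Q = if-mono-≤ (P⊆Q zero) (countF-mono (λ i → P⊆Q (suc i)))

countF-< : ∀ {n} {P Q : Fin n → Bool} → (∀ i → P i ≡ true → Q i ≡ true) →
           ∀ j → P j ≡ false → Q j ≡ true → countF P ℕ.< countF Q
countF-< {suc n} P⊆Q zero Pj Qj rewrite Pj | Qj = s≤s (countF-mono (λ i → P⊆Q (suc i)))
countF-< {suc n} P⊆Q (suc j) Pj Qj =
  if-mono-< (P⊆Q zero) (countF-< (λ i → P⊆Q (suc i)) j Pj Qj)

IsSRG⇒λ<k : ∀ {v} {Γ : Graph v} {k lam mu} → IsSRG Γ k lam mu → lam ℕ.< k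
IsSRG⇒λ<k {Γ = Γ} srg with IsSRG.notEdgeless srg
... | i , j , i~j = subst₂ ℕ._<_ (IsSRG.adjCommon srg i j i~j) (IsSRG.regular srg i)
                      (countF-< common⊆nbrs j j∉common i~j)
  where
  common⊆nbrs : ∀ w → adj Γ i w ∧ adj Γ j w ≡ true → adj Γ i w ≡ true
  common⊆nbrs w common with adj Γ i w
  ... | true = refl

  j∉common : adj Γ i j ∧ adj Γ j j ≡ false
  j∉common rewrite irrefl Γ j = ∧-zeroʳ (adj Γ i j)

i<j⇒0<j-i : ∀ {i j} → i ℤ.< j → + 0 ℤ.< j ℤ.- i
i<j⇒0<j-i {i} {j} i<j = subst (ℤ._< j ℤ.- i) (ℤP.+-inverseʳ i) (ℤP.+-monoˡ-< (ℤ.- i) i<j)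

-[i*j]<0 : ∀ i .{{_ : ℤ.Positive i}} {j} → + 0 ℤ.< j → ℤ.- (i ℤ.* j) ℤ.< + 0
-[i*j]<0 i {j} 0<j = ℤP.neg-mono-< (subst (ℤ._< i ℤ.* j) (ℤP.*-zeroʳ i) (ℤP.*-monoˡ-<-pos i 0<j))

R[1,y,0]≡ : ∀ v k lam y → R v k lam 0 (+ 1) y (+ 0) ≡
  ℤ.- (+ 2 ℤ.* (y ℤ.* (+ k ℤ.+ + 1) ℤ.- + v ℤ.* (+ 0 ℤ.+ + 1)))
R[1,y,0]≡ v k lam y = identity (+ v) (+ k) (+ lam) y
  where
  -- R unfolded, with + v, + k, + lam generalised to variables the solver can see.
  open import Data.Integer using (_+_; _*_; _-_; -_)
  identity : ∀ V K L y →
    + 1 * (+ 1 + + 1) * (V - y) - + 2 * + 1 * y * K + (+ 2 * + 1 + L - + 0 + + 1) * y * + 0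
      + y * (y - + 1) * + 0 - y * + 0 * + 0
    ≡ - (+ 2 * (y * (K + + 1) - V * (+ 0 + + 1)))
  identity = solve-∀

R[d,y,d]≡ : ∀ v k lam y d → R v k lam 0 d y d ≡
  ℤ.- (d ℤ.* ((y ℤ.* (+ k ℤ.+ + 1) ℤ.- + v ℤ.* (d ℤ.+ + 1)) ℤ.+ y ℤ.* (+ k ℤ.- + suc lam)))
R[d,y,d]≡ v k lam y d = identity (+ v) (+ k) (+ lam) y d
  where
  open import Data.Integer using (_+_; _*_; _-_; -_)
  identity : ∀ V K L y d →
    d * (d + + 1) * (V - y) - + 2 * d * y * K + (+ 2 * d + L - + 0 + + 1) * y * d
      + y * (y - + 1) * + 0 - y * d * d
    ≡ - (d * ((y * (K + + 1) - V * (d + + 1)) + y * (K - (+ 1 + L))))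
  identity = solve-∀

v[d+1]<y[k+1]⇒∃R<0 : ∀ {v k lam d y} → + 0 ℤ.≤ d → lam ℕ.< k →
  + v ℤ.* (d ℤ.+ + 1) ℤ.< y ℤ.* (+ k ℤ.+ + 1) → ∃ λ b → R v k lam 0 b y d ℤ.< + 0
v[d+1]<y[k+1]⇒∃R<0 {v} {k} {lam} {+ zero} {y} _ _ v<y[k+1] =
  + 1 , subst (ℤ._< + 0) (sym (R[1,y,0]≡ v k lam y)) (-[i*j]<0 (+ 2) (i<j⇒0<j-i v<y[k+1]))
v[d+1]<y[k+1]⇒∃R<0 {v} {k} {lam} {d@(+[1+ _ ])} {y} _ λ<k v[d+1]<y[k+1] =
  d , subst (ℤ._< + 0) (sym (R[d,y,d]≡ v k lam y d))
        (-[i*j]<0 d (ℤP.+-mono-<-≤ (i<j⇒0<j-i v[d+1]<y[k+1]) 0≤y[k-λ-1]))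
  where
  0<y : + 0 ℤ.< y
  0<y = ℤP.*-cancelʳ-<-nonNeg (+ k ℤ.+ + 1)
    (ℤP.≤-<-trans (subst (+ 0 ℤ.≤_) (ℤP.pos-* v _) (+≤+ z≤n)) v[d+1]<y[k+1])

  0≤y[k-λ-1] : + 0 ℤ.≤ y ℤ.* (+ k ℤ.- + suc lam)
  0≤y[k-λ-1] = subst (ℤ._≤ y ℤ.* (+ k ℤ.- + suc lam)) (ℤP.*-zeroʳ y)
    (ℤP.*-monoˡ-≤-nonNeg y {{ℤ.nonNegative (ℤP.<⇒≤ 0<y)}} (ℤP.i≤j⇒0≤j-i (+≤+ λ<k)))

open import Data.Rational using (mkℚ; 0ℚ; 1ℚ; _+_; _*_; _-_; -_; _<_; _≤_)
open import Data.Rational.Solver using (module +-*-Solver)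
open +-*-Solver using (solve; _:=_; _:+_; _:*_; _:-_; :-_; con)

ℤtoℚ≡mkℚ : ∀ i → ℤtoℚ i ≡ mkℚ i 0 (Coprime.sym (Coprime.1-coprimeTo ℤ.∣ i ∣))
ℤtoℚ≡mkℚ i = ℚP.↥p/↧p≡p (mkℚ i 0 _)

ℤtoℚ-homo-+ : ∀ i j → ℤtoℚ (i ℤ.+ j) ≡ ℤtoℚ i + ℤtoℚ j
ℤtoℚ-homo-+ i j rewrite ℤtoℚ≡mkℚ i | ℤtoℚ≡mkℚ j =
  ℚP./-cong (sym (cong₂ ℤ._+_ (ℤP.*-identityʳ i) (ℤP.*-identityʳ j))) refl

ℤtoℚ-homo-* : ∀ i j → ℤtoℚ (i ℤ.* j) ≡ ℤtoℚ i * ℤtoℚ j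
ℤtoℚ-homo-* i j rewrite ℤtoℚ≡mkℚ i | ℤtoℚ≡mkℚ j = refl

ℤtoℚ-mono-≤ : ∀ {i j} → i ℤ.≤ j → ℤtoℚ i ≤ ℤtoℚ j
ℤtoℚ-mono-≤ {i} {j} i≤j rewrite ℤtoℚ≡mkℚ i | ℤtoℚ≡mkℚ j =
  ℚ.*≤* (subst₂ ℤ._≤_ (sym (ℤP.*-identityʳ i)) (sym (ℤP.*-identityʳ j)) i≤j)

ℤtoℚ-cancel-< : ∀ {i j} → ℤtoℚ i < ℤtoℚ j → i ℤ.< j
ℤtoℚ-cancel-< {i} {j} i<j rewrite ℤtoℚ≡mkℚ i | ℤtoℚ≡mkℚ j with i<j
... | ℚ.*<* i*1<j*1 = subst₂ ℤ._<_ (ℤP.*-identityʳ i) (ℤP.*-identityʳ j) i*1<j*1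

p<q⇒0<q-p : ∀ {p q} → p < q → 0ℚ < q - p
p<q⇒0<q-p {p} {q} p<q = subst (_< q - p) (ℚP.+-inverseʳ p) (ℚP.+-monoˡ-< (- p) p<q)

p≤q⇒0≤q-p : ∀ {p q} → p ≤ q → 0ℚ ≤ q - p
p≤q⇒0≤q-p {p} {q} p≤q = subst (_≤ q - p) (ℚP.+-inverseʳ p) (ℚP.+-monoˡ-≤ (- p) p≤q)

0<q-p⇒p<q : ∀ {p q} → 0ℚ < q - p → p < q
0<q-p⇒p<q {p} {q} 0<q-p = subst₂ _<_ (ℚP.+-identityˡ p)
  (solve 2 (λ p q → (q :- p) :+ p := q) refl p q) (ℚP.+-monoˡ-< p 0<q-p)

p*q≡0⇒q≡0 : ∀ p .{{_ : ℚ.NonZero p}} {q} → p * q ≡ 0ℚ → q ≡ 0ℚ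
p*q≡0⇒q≡0 p {q} p*q≡0 = begin
  q                  ≡⟨ ℚP.*-identityˡ q ⟨
  1ℚ * q             ≡⟨ cong (_* q) (ℚP.*-inverseˡ p) ⟨
  ℚ.1/ p * p * q     ≡⟨ ℚP.*-assoc (ℚ.1/ p) p q ⟩
  ℚ.1/ p * (p * q)   ≡⟨ cong (ℚ.1/ p *_) p*q≡0 ⟩
  ℚ.1/ p * 0ℚ        ≡⟨ ℚP.*-zeroʳ (ℚ.1/ p) ⟩
  0ℚ                 ∎
  where open ≡-Reasoning

p÷q*q≡p : ∀ p q .{{_ : ℚ.NonZero q}} → (p ℚ.÷ q) * q ≡ p
p÷q*q≡p p q = begin
  p * ℚ.1/ q * q     ≡⟨ ℚP.*-assoc p (ℚ.1/ q) q ⟩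
  p * (ℚ.1/ q * q)   ≡⟨ cong (p *_) (ℚP.*-inverseˡ q) ⟩
  p * 1ℚ             ≡⟨ ℚP.*-identityʳ p ⟩
  p                  ∎
  where open ≡-Reasoning

divℚ[p,q]<r⇒p<r*q : ∀ {p q r} → 0ℚ < q → divℚ p q < r → p < r * q
divℚ[p,q]<r⇒p<r*q {p} {q} {r} 0<q = go
  where
  instance _ = ℚ.positive 0<q
  go : divℚ p q < r → p < r * q
  go with q ℚP.≟ 0ℚ
  ... | yes q≡0 = contradiction (sym q≡0) (ℚP.<⇒≢ 0<q)
  ... | no  q≢0 = λ p÷q<r →
    subst (_< r * q) (p÷q*q≡p p q {{ℚ.≢-nonZero q≢0}}) (ℚP.*-monoˡ-<-pos q p÷q<r)

module _ {a b ρ σ : ℚ} (ρ-root : ρ * ρ - a * ρ - b ≡ 0ℚ) (σ-root : σ * σ - a * σ - b ≡ 0ℚ)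
         (σ<ρ : σ < ρ) where

  roots-sum : ρ + σ - a ≡ 0ℚ
  roots-sum = p*q≡0⇒q≡0 (ρ - σ) {{ℚ.>-nonZero (p<q⇒0<q-p σ<ρ)}} (begin
    (ρ - σ) * (ρ + σ - a)                         ≡⟨ difference-of-values ⟩
    (ρ * ρ - a * ρ - b) - (σ * σ - a * σ - b)     ≡⟨ cong₂ _-_ ρ-root σ-root ⟩
    0ℚ - 0ℚ                                       ≡⟨⟩
    0ℚ                                            ∎)
    where
    open ≡-Reasoning
    difference-of-values : (ρ - σ) * (ρ + σ - a) ≡ (ρ * ρ - a * ρ - b) - (σ * σ - a * σ - b)
    difference-of-values = solve 4 (λ a b ρ σ →
      (ρ :- σ) :* (ρ :+ σ :- a) := (ρ :* ρ :- a :* ρ :- b) :- (σ :* σ :- a :* σ :- b)) refl a b ρ σ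

  quadratic-factorisation : ∀ t → t * t - a * t - b ≡ (ρ - t) * (σ - t)
  quadratic-factorisation t = begin
    t * t - a * t - b                                                ≡⟨ expand ⟩
    (ρ - t) * (σ - t) + (ρ * ρ - a * ρ - b) + (ρ + σ - a) * (t - ρ)  ≡⟨ cong₂ remainder ρ-root roots-sum ⟩
    (ρ - t) * (σ - t) + 0ℚ + 0ℚ * (t - ρ)                            ≡⟨ simplify ⟩
    (ρ - t) * (σ - t)                                                ∎
    where
    open ≡-Reasoning
    remainder : ℚ → ℚ → ℚ
    remainder f[ρ] s = (ρ - t) * (σ - t) + f[ρ] + s * (t - ρ)
    expand : t * t - a * t - b ≡ (ρ - t) * (σ - t) + (ρ * ρ - a * ρ - b) + (ρ + σ - a) * (t - ρ)
    expand = solve 5 (λ a b ρ σ t → t :* t :- a :* t :- b :=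
      (ρ :- t) :* (σ :- t) :+ (ρ :* ρ :- a :* ρ :- b) :+ (ρ :+ σ :- a) :* (t :- ρ)) refl a b ρ σ t
    simplify : (ρ - t) * (σ - t) + 0ℚ + 0ℚ * (t - ρ) ≡ (ρ - t) * (σ - t)
    simplify = solve 3 (λ ρ σ t → (ρ :- t) :* (σ :- t) :+ con 0ℚ :+ con 0ℚ :* (t :- ρ) :=
      (ρ :- t) :* (σ :- t)) refl ρ σ t

  smaller-root-≤ : ∀ {t} → t * t - a * t ≤ b → σ ≤ t
  smaller-root-≤ {t} f[t]≤b = ℚP.≮⇒≥ λ t<σ → ℚP.<-irrefl refl (ℚP.≤-<-trans f[t]≤b (b<f[t] t<σ))
    where
    b<f[t] : t < σ → b < t * t - a * t
    b<f[t] t<σ = 0<q-p⇒p<q (subst (0ℚ <_) (sym (quadratic-factorisation t))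
      (ℚP.positive⁻¹ _ {{ℚP.pos*pos⇒pos (ρ - t) {{ℚ.positive (p<q⇒0<q-p (ℚP.<-trans t<σ σ<ρ))}}
                                         (σ - t) {{ℚ.positive (p<q⇒0<q-p t<σ)}}}}))

IsSRG⇒σ≤-1 : ∀ {v} {Γ : Graph v} {k lam mu ρ σ} →
             IsSRG Γ k lam mu → RestrictedEigenvalues k lam mu ρ σ → σ ≤ - 1ℚ
IsSRG⇒σ≤-1 {k = k} {lam} {mu} srg (ρ-root , σ-root , σ<ρ) =
  smaller-root-≤ {a} {b} ρ-root σ-root σ<ρ (subst (_≤ b) (sym f[-1]≡1+a) 1+a≤b)
  where
  a = ℤtoℚ (+ lam ℤ.- + mu)
  b = ℤtoℚ (+ k ℤ.- + mu)

  f[-1]≡1+a : - 1ℚ * - 1ℚ - a * - 1ℚ ≡ 1ℚ + a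
  f[-1]≡1+a = solve 1 (λ a → :- con 1ℚ :* :- con 1ℚ :- a :* :- con 1ℚ := con 1ℚ :+ a) refl a

  1+a≤b : 1ℚ + a ≤ b
  1+a≤b = subst (_≤ b) (ℤtoℚ-homo-+ (+ 1) (+ lam ℤ.- + mu)) (ℤtoℚ-mono-≤
    (subst (ℤ._≤ + k ℤ.- + mu) (ℤP.+-assoc (+ 1) (+ lam) (ℤ.- + mu))
      (ℤP.+-monoˡ-≤ (ℤ.- + mu) (+≤+ (IsSRG⇒λ<k srg)))))

v[d-σ]<y[k-σ]⇒v[d+1]<y[k+1] : ∀ {v k d y σ} → σ ≤ - 1ℚ → y ≤ v →
  v * (d - σ) < y * (k - σ) → v * (d + 1ℚ) < y * (k + 1ℚ)
v[d-σ]<y[k-σ]⇒v[d+1]<y[k+1] {v} {k} {d} {y} {σ} σ≤-1 y≤v v[d-σ]<y[k-σ] =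
  0<q-p⇒p<q (subst (0ℚ <_) rearrange (ℚP.+-mono-<-≤ (p<q⇒0<q-p v[d-σ]<y[k-σ]) 0≤[v-y][-1-σ]))
  where
  0≤[v-y][-1-σ] : 0ℚ ≤ (v - y) * (- 1ℚ - σ)
  0≤[v-y][-1-σ] = ℚP.nonNegative⁻¹ _
    {{ℚP.nonNeg*nonNeg⇒nonNeg (v - y) {{ℚ.nonNegative (p≤q⇒0≤q-p y≤v)}}
                              (- 1ℚ - σ) {{ℚ.nonNegative (p≤q⇒0≤q-p σ≤-1)}}}}

  rearrange : (y * (k - σ) - v * (d - σ)) + (v - y) * (- 1ℚ - σ) ≡ y * (k + 1ℚ) - v * (d + 1ℚ)
  rearrange = solve 5 (λ v k d y σ →
    (y :* (k :- σ) :- v :* (d :- σ)) :+ (v :- y) :* (:- con 1ℚ :- σ) :=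
    y :* (k :+ con 1ℚ) :- v :* (d :+ con 1ℚ)) refl v k d y σ

Haem≥<y⇒v[d+1]<y[k+1] : ∀ v k d {σ y} → σ ≤ - 1ℚ → y ℤ.≤ + v → Haem≥ v k σ d < ℤtoℚ y →
                        + v ℤ.* (d ℤ.+ + 1) ℤ.< y ℤ.* (+ k ℤ.+ + 1)
Haem≥<y⇒v[d+1]<y[k+1] v k d {σ} {y} σ≤-1 y≤v Haem<y =
  ℤtoℚ-cancel-< (subst₂ _<_ (sym (ℤtoℚ-factor (+ v) d)) (sym (ℤtoℚ-factor y (+ k)))
    (v[d-σ]<y[k-σ]⇒v[d+1]<y[k+1] {ℤtoℚ (+ v)} {ℤtoℚ (+ k)} {ℤtoℚ d} σ≤-1 (ℤtoℚ-mono-≤ y≤v)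
      (divℚ[p,q]<r⇒p<r*q 0<k-σ Haem<y)))
  where
  0<k-σ : 0ℚ < ℤtoℚ (+ k) - σ
  0<k-σ = p<q⇒0<q-p
    (ℚP.<-≤-trans (ℚP.≤-<-trans σ≤-1 (ℚ.*<* ℤ.-<+)) (ℤtoℚ-mono-≤ {+ 0} {+ k} (+≤+ z≤n)))

  ℤtoℚ-factor : ∀ i j → ℤtoℚ (i ℤ.* (j ℤ.+ + 1)) ≡ ℤtoℚ i * (ℤtoℚ j + 1ℚ)
  ℤtoℚ-factor i j = trans (ℤtoℚ-homo-* i _) (cong (ℤtoℚ i *_) (ℤtoℚ-homo-+ j (+ 1)))

lemma5p3 : (v k lam mu : ℕ) (Γ : Graph v) → IsSRG Γ k lam mu → mu ≡ 0
    → (ρ σ : ℚ) → RestrictedEigenvalues k lam mu ρ σ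
    → (d : ℤ) → + 0 ℤ.≤ d → d ℤ.≤ + k
    → (y : ℤ) → Haem≥ v k σ d ℚ.< ℤtoℚ y → y ℤ.< + v
    → ∃ λ (b : ℤ) → R v k lam mu b y d ℤ.< + 0
lemma5p3 v k lam .0 Γ srg refl ρ σ eigenvalues d 0≤d _ y Haem<y y<v =
  v[d+1]<y[k+1]⇒∃R<0 0≤d (IsSRG⇒λ<k srg)
    (Haem≥<y⇒v[d+1]<y[k+1] v k d (IsSRG⇒σ≤-1 srg eigenvalues) (ℤP.<⇒≤ y<v) Haem<y)
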